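{- Assume the image axiom stated in the context. Let $V$ be a locally $U$-small type with an equivalence $\sup:\mathcal{P}_U V\simeq V$, and for $x:V$ and $y\equiv\sup(A,f)$ define $x\in y:=\sum_{a:A}f\,a=x$. Then for every $u:V$ and $r:\prod_{x:V}(x\in u)\to V$ there is $v:V$ such that for all $z:V$, $(z\in v)\simeq \exists_{x:V}\exists_{i:x\in u}\, r\,x\,i=z$.
   Context: Homotopy type theory with a univalent universe $U$ inside a larger univalent universe $\mathrm{Type}$; $\exists$ is the propositionally truncated $\Sigma$. A type is essentially $U$-small if equivalent to a type in $U$; locally $U$-small if each of its identity types is essentially $U$-small. $A\hookrightarrow B$ denotes embeddings and $A\twoheadrightarrow B$ surjections. $\mathcal{P}_U X:=\sum_{A:U}(A\hookrightarrow X)$. Image axiom: for every $A:U$, locally $U$-small $X:\mathrm{Type}$ and $f:A\to X$ there are $\mathrm{image}\,f:U$, $\mathrm{surj}\,f:A\twoheadrightarrow\mathrm{image}\,f$ and $\mathrm{incl}\,f:\mathrm{image}\,f\hookrightarrow X$ with $\mathrm{incl}\,f(\mathrm{surj}\,f\,a)\equiv f\,a$. -}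

{-# OPTIONS --without-K #-}
module Defs where

open import Level using (Level; _⊔_; Setω) renaming (suc to lsuc)
open import Data.Product using (Σ; Σ-syntax; _,_; proj₁; proj₂; _×_)
open import Relation.Binary.PropositionalEquality using (_≡_; refl; cong)

private
  variable
    a b : Level

isContr : Set a → Set a
isContr A = Σ[ c ∈ A ] ((x : A) → c ≡ x)

isProp : Set a → Set a
isProp A = (x y : A) → x ≡ y

fiber : {A : Set a} {B : Set b} → (A → B) → B → Set (a ⊔ b)
fiber {A = A} f y = Σ[ x ∈ A ] (f x ≡ y)

isEquiv : {A : Set a} {B : Set b} → (A → B) → Set (a ⊔ b)
isEquiv {B = B} f = (y : B) → isContr (fiber f y)

_≃_ : Set a → Set b → Set (a ⊔ b)
A ≃ B = Σ[ f ∈ (A → B) ] isEquiv f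

infix 4 _≃_

eqvFun : {A : Set a} {B : Set b} → A ≃ B → A → B
eqvFun e = proj₁ e

eqvInv : {A : Set a} {B : Set b} → A ≃ B → B → A
eqvInv e y = proj₁ (proj₁ (proj₂ e y))

idtoeqv : {A B : Set a} → A ≡ B → A ≃ B
idtoeqv refl = (λ x → x) , λ y → (y , refl) , λ { (x , refl) → refl }

Univalence : (a : Level) → Set (lsuc a)
Univalence a = (A B : Set a) → isEquiv (idtoeqv {A = A} {B = B})

FunExt : (a b : Level) → Set (lsuc (a ⊔ b))
FunExt a b = {A : Set a} {B : A → Set b} (f g : (x : A) → B x) →
             isEquiv (λ (p : f ≡ g) → λ x → cong (λ h → h x) p)

record PropTrunc : Setω where
  field
    ∥_∥    : {a : Level} → Set a → Set a
    ∣_∣    : {a : Level} {A : Set a} → A → ∥ A ∥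
    trunc  : {a : Level} {A : Set a} → isProp ∥ A ∥
    ∥∥-rec : {a b : Level} {A : Set a} {P : Set b} → isProp P → (A → P) → ∥ A ∥ → P

∃ₜ : (pt : PropTrunc) {A : Set a} → (A → Set b) → Set (a ⊔ b)
∃ₜ pt {A = A} B = PropTrunc.∥_∥ pt (Σ A B)

isEmbedding : {A : Set a} {B : Set b} → (A → B) → Set (a ⊔ b)
isEmbedding {A = A} f = (x y : A) → isEquiv (cong f {x} {y})

_↪_ : Set a → Set b → Set (a ⊔ b)
A ↪ B = Σ[ f ∈ (A → B) ] isEmbedding f

isSurjection : (pt : PropTrunc) {A : Set a} {B : Set b} → (A → B) → Set (a ⊔ b)
isSurjection pt {B = B} f = (y : B) → PropTrunc.∥_∥ pt (fiber f y)

Surj : (pt : PropTrunc) → Set a → Set b → Set (a ⊔ b)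
Surj pt A B = Σ[ f ∈ (A → B) ] isSurjection pt f

isEssentiallySmall : (ℓ : Level) → Set b → Set (lsuc ℓ ⊔ b)
isEssentiallySmall ℓ X = Σ[ A ∈ Set ℓ ] (A ≃ X)

isLocallySmall : (ℓ : Level) → Set b → Set (lsuc ℓ ⊔ b)
isLocallySmall ℓ X = (x y : X) → isEssentiallySmall ℓ (x ≡ y)

𝒫 : (ℓ : Level) → Set b → Set (lsuc ℓ ⊔ b)
𝒫 ℓ X = Σ[ A ∈ Set ℓ ] (A ↪ X)

-- Image axiom for U = Set ℓ and Type = Set (lsuc ℓ); the judgemental equation
-- incl f (surj f a) ≡ f a is rendered as a propositional equality.
ImageAxiom : (pt : PropTrunc) (ℓ : Level) → Set (lsuc (lsuc ℓ))
ImageAxiom pt ℓ =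
  (A : Set ℓ) (X : Set (lsuc ℓ)) → isLocallySmall ℓ X → (f : A → X) →
  Σ[ im ∈ Set ℓ ] Σ[ s ∈ Surj pt A im ] Σ[ i ∈ im ↪ X ]
    ((x : A) → proj₁ i (proj₁ s x) ≡ f x)

Mem : {ℓ : Level} {V : Set (lsuc ℓ)} → 𝒫 ℓ V ≃ V → V → V → Set (lsuc ℓ)
Mem sup x y = Σ[ a ∈ proj₁ (eqvInv sup y) ] (proj₁ (proj₂ (eqvInv sup y)) a ≡ x)

{-# OPTIONS --without-K #-}
module Submission where

-- Take v := sup (image g) for g a := r (f a) (a , refl), where (A , f) = sup⁻¹ u.
-- Membership in sup (B , i) is the fibre of the embedding i, a proposition; for the
-- image embedding it is therefore equivalent to the truncated fibre of g, and the
-- pairs (x , i : x ∈ u) are just the elements a of A reindexed along f.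

open import Defs
open import Level using (Level) renaming (suc to lsuc)
open import Data.Product using (Σ; Σ-syntax; _,_; proj₁; proj₂)
open import Function using (_∘_)
open import Relation.Binary.PropositionalEquality
  using (_≡_; refl; sym; trans; cong; subst; trans-reflʳ; trans-symˡ; trans-assoc)

private
  variable
    a b c : Level

isProp→isSet : {A : Set a} → isProp A → (x y : A) (p q : x ≡ y) → p ≡ q
isProp→isSet {A = A} isPropA x y p q = trans (canonical p) (sym (canonical q))
  where
  h : (w : A) → x ≡ w
  h w = isPropA x w

  h-natural : {w : A} (p : x ≡ w) → trans (h x) p ≡ h w
  h-natural refl = trans-reflʳ (h x)

  canonical : (p : x ≡ y) → p ≡ trans (sym (h x)) (h y)
  canonical p = trans (cong (λ t → trans t p) (sym (trans-symˡ (h x))))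
                      (trans (trans-assoc (sym (h x))) (cong (trans (sym (h x))) (h-natural p)))

isProp-⇔→≃ : {A : Set a} {B : Set b} → isProp A → isProp B → (A → B) → (B → A) → A ≃ B
isProp-⇔→≃ {A = A} {B} isPropA isPropB f g =
  f , λ y → (g y , isPropB _ _) , λ { (x , p) → ≡-in-fiber (isPropA (g y) x) _ p }
  where
  ≡-in-fiber : {y : B} {x x′ : A} → x ≡ x′ → (p : f x ≡ y) (p′ : f x′ ≡ y) →
            _≡_ {A = fiber f y} (x , p) (x′ , p′)
  ≡-in-fiber {x = x} refl p p′ = cong (x ,_) (isProp→isSet isPropB _ _ p p′)

eqvInv-eqvFun : {A : Set a} {B : Set b} (e : A ≃ B) (x : A) → eqvInv e (eqvFun e x) ≡ x
eqvInv-eqvFun e x = cong proj₁ (proj₂ (proj₂ e (eqvFun e x)) (x , refl))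

fiber-≡ : {A : Set a} {B : Set b} (h : A → B) {z : B} {x x′ : A}
          (q : x ≡ x′) (p : h x ≡ z) (p′ : h x′ ≡ z) →
          cong h q ≡ trans p (sym p′) → _≡_ {A = fiber h z} (x , p) (x′ , p′)
fiber-≡ h {x = x} refl p refl e = cong (x ,_) (trans (sym (trans-reflʳ p)) (sym e))

isEmbedding→isProp-fiber : {A : Set a} {B : Set b} (h : A → B) → isEmbedding h →
                           (z : B) → isProp (fiber h z)
isEmbedding→isProp-fiber h emb z (x , p) (x′ , p′) = fiber-≡ h q p p′ q-spec
  where
  q = proj₁ (proj₁ (emb x x′ (trans p (sym p′))))
  q-spec = proj₂ (proj₁ (emb x x′ (trans p (sym p′))))

module _ (pt : PropTrunc) where
  open PropTrunc pt

  image-fiber≃∥fiber∥ :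
    {A : Set a} {I : Set b} {X : Set c} (g : A → X)
    (s : Surj pt A I) (i : I ↪ X) → ((x : A) → proj₁ i (proj₁ s x) ≡ g x) →
    (z : X) → fiber (proj₁ i) z ≃ ∥ fiber g z ∥
  image-fiber≃∥fiber∥ g (s , s-surj) (i , i-emb) i∘s≡g z =
    isProp-⇔→≃ (isEmbedding→isProp-fiber i i-emb z) trunc to from
    where
    to : fiber i z → ∥ fiber g z ∥
    to (b , p) = ∥∥-rec trunc
      (λ { (x , q) → ∣ x , trans (sym (i∘s≡g x)) (trans (cong i q) p) ∣ }) (s-surj b)

    from : ∥ fiber g z ∥ → fiber i z
    from = ∥∥-rec (isEmbedding→isProp-fiber i i-emb z)
      (λ { (x , p) → s x , trans (i∘s≡g x) p })

  ∥fiber∥≃∃-over-fibers :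
    {A : Set a} {X : Set b} {Z : Set c} (f : A → X) (r : (x : X) → fiber f x → Z) (z : Z) →
    ∥ fiber (λ x → r (f x) (x , refl)) z ∥ ≃ ∃ₜ pt (λ (x : X) → ∃ₜ pt (λ (i : fiber f x) → r x i ≡ z))
  ∥fiber∥≃∃-over-fibers f r z = isProp-⇔→≃ trunc trunc
    (∥∥-rec trunc λ { (x , p) → ∣ f x , ∣ (x , refl) , p ∣ ∣ })
    (∥∥-rec trunc λ { (y , t) → ∥∥-rec trunc (λ { ((x , refl) , p) → ∣ x , p ∣ }) t })

Mem-sup : {ℓ : Level} {V : Set (lsuc ℓ)} (sup : 𝒫 ℓ V ≃ V) (z : V) (P : 𝒫 ℓ V) →
          Mem sup z (eqvFun sup P) ≡ fiber (proj₁ (proj₂ P)) z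
Mem-sup sup z P = cong (λ Q → fiber (proj₁ (proj₂ Q)) z) (eqvInv-eqvFun sup P)

mainTheorem7 : (ℓ : Level) (pt : PropTrunc)
    → Univalence ℓ → Univalence (lsuc ℓ) → FunExt ℓ ℓ → FunExt ℓ (lsuc ℓ) → FunExt (lsuc ℓ) (lsuc ℓ)
    → ImageAxiom pt ℓ
    → (V : Set (lsuc ℓ)) → isLocallySmall ℓ V → (sup : 𝒫 ℓ V ≃ V)
    → (u : V) (r : (x : V) → Mem sup x u → V)
    → Σ[ v ∈ V ] ((z : V) → Mem sup z v ≃ ∃ₜ pt (λ (x : V) → ∃ₜ pt (λ (i : Mem sup x u) → r x i ≡ z)))
mainTheorem7 ℓ pt _ _ _ _ _ imageAxiom V V-locallySmall sup u r = eqvFun sup P , membership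
  where
  f = proj₁ (proj₂ (eqvInv sup u))

  g : proj₁ (eqvInv sup u) → V
  g x = r (f x) (x , refl)

  image = imageAxiom (proj₁ (eqvInv sup u)) V V-locallySmall g
  P = proj₁ image , proj₁ (proj₂ (proj₂ image))

  membership : (z : V) → Mem sup z (eqvFun sup P) ≃ _
  membership z = subst (_≃ _) (sym (Mem-sup sup z P))
    (isProp-⇔→≃ (isEmbedding→isProp-fiber _ (proj₂ (proj₂ P)) z) (PropTrunc.trunc pt)
      (eqvFun (∥fiber∥≃∃-over-fibers pt f r z) ∘ eqvFun image≃)
      (eqvInv image≃ ∘ eqvInv (∥fiber∥≃∃-over-fibers pt f r z)))
    where
    image≃ = image-fiber≃∥fiber∥ pt g (proj₁ (proj₂ image)) (proj₁ (proj₂ (proj₂ image)))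
                                  (proj₂ (proj₂ (proj₂ image))) z
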